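{- Let $\ell\ge1$, let $V=\{0,1\}^{\ell^2}$, and let $\varphi_1$ be the CFLS coloring of the complete graph on $V$ defined in the context. Let $p\ge 3$ and let $w_1,\dots,w_p\in V$ be distinct, viewed as a copy of $K_p$ with edges colored by $c=\varphi_1$. Let $C_1,\dots,C_r$ be the colors appearing on this $K_p$ and let $D$ be the auxiliary digraph defined in the context, with each directed edge labelled Odd or Even. Then $D$ contains no directed cycle (a sequence of distinct colors $C_{j_1},\dots,C_{j_m}$, $m\ge1$, with $C_{j_t}\to C_{j_{t+1}}$ an edge of $D$ for $t<m$ and $C_{j_m}\to C_{j_1}$ an edge of $D$; for $m=1$ this is a loop) in which at least one of its edges is Odd.
   Context: Let $\ell$ be a positive integer and $V=\{0,1\}^{\ell^2}$. For $v\in V$ write $v=(v^{(1)},\dots,v^{(\ell)})$ where each block $v^{(k)}\in\{0,1\}^{\ell}$ consists of $\ell$ consecutive bits. For distinct $x,y\in V$ define \[\varphi_1(x,y)=\big((i,\{x^{(i)},y^{(i)}\}),\,i_1,\dots,i_\ell\big),\] where $i$ is the least index with $x^{(i)}\ne y^{(i)}$, and for each $k=1,\dots,\ell$, $i_k=0$ if $x^{(k)}=y^{(k)}$ and otherwise $i_k$ is the least position $j\in\{1,\dots,\ell\}$ at which the $j$-th bit of $x^{(k)}$ differs from the $j$-th bit of $y^{(k)}$. This is a symmetric edge-coloring of the complete graph on $V$ (the CFLS coloring). Auxiliary digraph: given an edge-coloring $c$ of a $K_p$ with color set $\{C_1,\dots,C_r\}$, $D$ has vertex set $\{C_1,\dots,C_r\}$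 and a directed edge $C_i\to C_j$ (possibly $i=j$, and possibly several parallel edges) whenever there exist distinct vertices $v_1,\dots,v_k$ of the $K_p$ with $k\ge3$ such that $c(v_1v_2)=c(v_2v_3)=\dots=c(v_{k-1}v_k)=C_i$ and $c(v_kv_1)=C_j$; such a directed edge is labelled Odd if $k$ is odd and Even if $k$ is even (edges with both labels may occur). -}

module Defs where

open import Data.Nat using (ℕ; zero; suc; _≤_; _%_)
open import Data.Nat.DivMod using (_mod_)
open import Data.Bool using (Bool) renaming (_≟_ to _≟B_)
open import Data.Fin using (Fin; zero; suc; toℕ; inject₁; fromℕ)
open import Data.Vec using (Vec; []; _∷_; lookup; map)
open import Data.Vec.Properties using (≡-dec)
open import Data.Maybe using (Maybe; just; nothing) renaming (map to mapMaybe)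
open import Data.Product using (Σ; _×_; _,_; ∃; ∃-syntax)
open import Data.Sum using (_⊎_)
open import Data.Unit using (⊤)
open import Data.Empty using (⊥)
open import Relation.Nullary using (yes; no)
open import Relation.Binary.PropositionalEquality using (_≡_)
open import Relation.Binary.Definitions using (DecidableEquality)
open import Function.Definitions using (Injective)

-- V = {0,1}^(ℓ²), stored as ℓ consecutive blocks of ℓ bits each.
V : ℕ → Set
V ℓ = Vec (Vec Bool ℓ) ℓ

firstDiff : ∀ {A : Set} {m} → DecidableEquality A → Vec A m → Vec A m → Maybe (Fin m)
firstDiff _≟_ [] [] = nothing
firstDiff _≟_ (a ∷ as) (b ∷ bs) with a ≟ b
... | no _ = just zero
... | yes _ = mapMaybe suc (firstDiff _≟_ as bs)

-- i_k as in the paper: 0 if the blocks agree, otherwise the least 1-based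
-- position j at which they differ.
blockDiff : ∀ {ℓ} → Vec Bool ℓ → Vec Bool ℓ → ℕ
blockDiff a b with firstDiff _≟B_ a b
... | nothing = 0
... | just j = suc (toℕ j)

-- A colour: (first differing block index i (0-based) with the two blocks
-- x^(i), y^(i), stored as an ordered pair but compared as an unordered pair),
-- together with the vector (i_1, ..., i_ℓ).  The Maybe is `nothing` only
-- for x = y, which never occurs for edges.
Color : ℕ → Set
Color ℓ = Maybe (Fin ℓ × Vec Bool ℓ × Vec Bool ℓ) × Vec ℕ ℓ

φ₁ : ∀ {ℓ} → V ℓ → V ℓ → Color ℓ
φ₁ x y =
  ( mapMaybe (λ i → i , lookup x i , lookup y i) (firstDiff (≡-dec _≟B_) x y)
  , Data.Vec.zipWith blockDiff x y )

_≈ᶜ_ : ∀ {ℓ} → Color ℓ → Color ℓ → Set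
(nothing , is) ≈ᶜ (nothing , js) = is ≡ js
(nothing , is) ≈ᶜ (just _ , js) = ⊥
(just _ , is) ≈ᶜ (nothing , js) = ⊥
(just (i , a , b) , is) ≈ᶜ (just (i' , a' , b') , js) =
  i ≡ i' × ((a ≡ a' × b ≡ b') ⊎ (a ≡ b' × b ≡ a')) × is ≡ js

col : ∀ {ℓ p} → (Fin p → V ℓ) → Fin p → Fin p → Color ℓ
col w a b = φ₁ (w a) (w b)

-- A witness for a directed edge C → C' of the auxiliary digraph D with
-- k = suc k' vertices v_1 … v_k (k ≥ 3), distinct vertices of the K_p:
-- c(v_t v_{t+1}) = C for t < k and c(v_k v_1) = C'.
DEdgeWith : ∀ {ℓ p} → (Fin p → V ℓ) → Color ℓ → Color ℓ → ℕ → Set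
DEdgeWith {p = p} w C C' k' =
  2 ≤ k' ×
  Σ (Fin (suc k') → Fin p) λ v →
    Injective _≡_ _≡_ v ×
    (∀ (t : Fin k') → col w (v (inject₁ t)) (v (suc t)) ≈ᶜ C) ×
    col w (v (fromℕ k')) (v zero) ≈ᶜ C'

DEdge : ∀ {ℓ p} → (Fin p → V ℓ) → Color ℓ → Color ℓ → Set
DEdge w C C' = ∃[ k' ] DEdgeWith w C C' k'

OddDEdge : ∀ {ℓ p} → (Fin p → V ℓ) → Color ℓ → Color ℓ → Set
OddDEdge w C C' = ∃[ k' ] (DEdgeWith w C C' k' × suc k' % 2 ≡ 1)

csuc : ∀ {m'} → Fin (suc m') → Fin (suc m')
csuc {m'} t = suc (toℕ t) mod (suc m')

OddCycle : ∀ {ℓ p} → (Fin p → V ℓ) → Set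
OddCycle {ℓ} w =
  Σ ℕ λ m' → Σ (Fin (suc m') → Color ℓ) λ C →
    (∀ a b → C a ≈ᶜ C b → a ≡ b) ×
    (∀ t → DEdge w (C t) (C (csuc t))) ×
    (∃[ t ] OddDEdge w (C t) (C (csuc t)))

-- The *level* of a colour is the first block in which the two
-- endpoints of an edge of that colour differ.  Let C → C' be an edge of D,
-- witnessed by distinct v_1, …, v_k whose first k-1 steps have colour C and
-- whose closing step v_k v_1 has colour C'.
--   (1) Every C-step fixes the blocks below level C, so v_k and v_1 agree
--       there: level C ≤ level C'.
--   (2) At block i = level C every C-step exchanges the two members of the
--       unordered pair {a, b} recorded in C (and a ≠ b).  If k is odd, the
--       number k-1 of C-steps is even, so v_k and v_1 also agree at block i:
--       level C < level C'.
-- Along a directed cycle of D the level is therefore nondecreasing, and it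
-- increases strictly across an Odd edge.  But a function on Fin m that is
-- nondecreasing along the cyclic successor cannot increase strictly anywhere,
-- since iterating the successor m times returns to the start.

module Submission where

open import Defs
open import Data.Nat using (ℕ; zero; suc; _≤_; _<_; _+_; _*_; _%_; _/_; z≤n; s≤s)
open import Data.Nat.Properties
  using (≤-refl; ≤-trans; <-≤-trans; <-irrefl; ≮⇒≥; m≤n⇒m<n∨m≡n; m≤n+m; +-suc; +-identityʳ; suc-injective; 0≢1+n; <⇒≢)
open import Data.Nat.DivMod
  using (_mod_; m<n⇒m%n≡m; m≡m%n+[m/n]*n; [m+n]%n≡m%n; %-distribˡ-+; m%n%n≡m%n)
open import Data.Fin using (Fin; zero; suc; toℕ; inject₁; fromℕ; fromℕ<)
open import Data.Fin.Properties using (toℕ-injective; toℕ-fromℕ<; toℕ-fromℕ; toℕ-inject₁; toℕ<n)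
open import Data.Vec using (Vec; []; _∷_; lookup)
open import Data.Vec.Properties using (≡-dec)
open import Data.Bool using (Bool) renaming (_≟_ to _≟B_)
open import Data.Maybe using (Maybe; just; nothing)
open import Data.Product using (_×_; _,_; ∃; proj₁; proj₂)
open import Data.Sum using (_⊎_; inj₁; inj₂)
open import Data.Empty using (⊥-elim)
open import Relation.Nullary using (¬_; yes; no)
open import Relation.Binary.PropositionalEquality
  using (_≡_; _≢_; refl; sym; trans; cong; subst; subst₂; module ≡-Reasoning)
open import Relation.Binary.Definitions using (DecidableEquality)
open import Function.Definitions using (Injective)

AgreeBelow : ∀ {A : Set} {m} → ℕ → Vec A m → Vec A m → Set
AgreeBelow n x y = ∀ j → toℕ j < n → lookup x j ≡ lookup y j

agreeBelow-sym : ∀ {A : Set} {m n} {x y : Vec A m} → AgreeBelow n x y → AgreeBelow n y x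
agreeBelow-sym agree j j<n = sym (agree j j<n)

agreeBelow-extend : ∀ {A : Set} {m} {x y : Vec A m} (i : Fin m) →
  AgreeBelow (toℕ i) x y → lookup x i ≡ lookup y i → AgreeBelow (suc (toℕ i)) x y
agreeBelow-extend i agree same j (s≤s j≤i) with m≤n⇒m<n∨m≡n j≤i
... | inj₁ j<i = agree j j<i
... | inj₂ j≡i with refl ← toℕ-injective {i = j} {j = i} j≡i = same

module FirstDiff {A : Set} (_≟_ : DecidableEquality A) where

  firstDiff-just : ∀ {m} (x y : Vec A m) {i} → firstDiff _≟_ x y ≡ just i →
                   AgreeBelow (toℕ i) x y × lookup x i ≢ lookup y i
  firstDiff-just (a ∷ as) (b ∷ bs) found with a ≟ b
  ... | no a≢b with refl ← found = (λ _ ()) , a≢b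
  ... | yes a≡b with firstDiff _≟_ as bs in rest
  ...   | just i with refl ← found = agree , proj₂ (firstDiff-just as bs rest)
    where
      agree : AgreeBelow (suc (toℕ i)) (a ∷ as) (b ∷ bs)
      agree zero _ = a≡b
      agree (suc j) (s≤s j<i) = proj₁ (firstDiff-just as bs rest) j j<i
  firstDiff-just (a ∷ as) (b ∷ bs) () | yes _ | nothing

  firstDiff-nothing : ∀ {m} (x y : Vec A m) → firstDiff _≟_ x y ≡ nothing → x ≡ y
  firstDiff-nothing [] [] _ = refl
  firstDiff-nothing (a ∷ as) (b ∷ bs) none with a ≟ b
  firstDiff-nothing (a ∷ as) (b ∷ bs) () | no _
  ... | yes refl with firstDiff _≟_ as bs in rest
  firstDiff-nothing (a ∷ as) (b ∷ bs) () | yes refl | just _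
  ...   | nothing = cong (a ∷_) (firstDiff-nothing as bs rest)

  firstDiff-≢ : ∀ {m} (x y : Vec A m) → x ≢ y → ∃ λ i → firstDiff _≟_ x y ≡ just i
  firstDiff-≢ x y x≢y with firstDiff _≟_ x y in found
  ... | just i = i , refl
  ... | nothing = ⊥-elim (x≢y (firstDiff-nothing x y found))

  firstDiff-beyond : ∀ {m n} (x y : Vec A m) {j} →
    AgreeBelow n x y → firstDiff _≟_ x y ≡ just j → n ≤ toℕ j
  firstDiff-beyond x y agree found =
    ≮⇒≥ (λ j<n → proj₂ (firstDiff-just x y found) (agree _ j<n))

open module BlockDiff {ℓ : ℕ} = FirstDiff (≡-dec {A = Bool} {n = ℓ} _≟B_)

firstBlock : ∀ {ℓ} → V ℓ → V ℓ → Maybe (Fin ℓ)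
firstBlock = firstDiff (≡-dec _≟B_)

SamePair : ∀ {A : Set} → A → A → A → A → Set
SamePair p q a b = (p ≡ a × q ≡ b) ⊎ (p ≡ b × q ≡ a)

samePair-distinct : ∀ {A : Set} {p q a b : A} → SamePair p q a b → p ≢ q → a ≢ b
samePair-distinct (inj₁ (refl , refl)) p≢q = p≢q
samePair-distinct (inj₂ (refl , refl)) p≢q = λ b≡a → p≢q (sym b≡a)

samePair-return : ∀ {A : Set} {p q r a b : A} → a ≢ b →
  SamePair p q a b → SamePair q r a b → r ≡ p
samePair-return a≢b (inj₁ (_ , q≡b)) (inj₁ (q≡a , _)) = ⊥-elim (a≢b (trans (sym q≡a) q≡b))
samePair-return a≢b (inj₁ (p≡a , q≡b)) (inj₂ (_ , r≡a)) = trans r≡a (sym p≡a)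
samePair-return a≢b (inj₂ (p≡b , q≡a)) (inj₁ (_ , r≡b)) = trans r≡b (sym p≡b)
samePair-return a≢b (inj₂ (_ , q≡a)) (inj₂ (q≡b , _)) = ⊥-elim (a≢b (trans (sym q≡a) q≡b))

level : ∀ {ℓ} → Color ℓ → ℕ
level (just (i , _) , _) = toℕ i
level (nothing , _) = 0

φ₁-level : ∀ {ℓ} {x y : V ℓ} {j} (C : Color ℓ) →
  φ₁ x y ≈ᶜ C → firstBlock x y ≡ just j → level C ≡ toℕ j
φ₁-level {x = x} {y} (just _ , _) same found with firstBlock x y
φ₁-level (just _ , _) (refl , _) refl | just _ = refl
φ₁-level {x = x} {y} (nothing , _) same found with firstBlock x y
φ₁-level (nothing , _) () refl | just _

φ₁-pair : ∀ {ℓ} {x y : V ℓ} {i a b is} → φ₁ x y ≈ᶜ (just (i , a , b) , is) →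
  firstBlock x y ≡ just i × SamePair (lookup x i) (lookup y i) a b
φ₁-pair {x = x} {y} same with firstBlock x y
φ₁-pair (refl , pair , _) | just _ = refl , pair

φ₁-defined : ∀ {ℓ} {x y : V ℓ} {is} → x ≢ y → ¬ φ₁ x y ≈ᶜ (nothing , is)
φ₁-defined {x = x} {y} x≢y same with firstBlock x y | firstDiff-≢ x y x≢y
φ₁-defined x≢y () | just _ | _
φ₁-defined x≢y same | nothing | _ , ()

module MonochromaticWalk {ℓ} (X : ℕ → V ℓ) (k' : ℕ) (i : Fin ℓ) (a b : Vec Bool ℓ) (is : Vec ℕ ℓ)
  (step : ∀ n → n < k' → φ₁ (X n) (X (suc n)) ≈ᶜ (just (i , a , b) , is)) where

  walk-agreeBelow : ∀ n → n ≤ k' → AgreeBelow (toℕ i) (X 0) (X n)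
  walk-agreeBelow zero _ j _ = refl
  walk-agreeBelow (suc n) n<k' j j<i =
    trans (walk-agreeBelow n (≤-trans (m≤n+m n 1) n<k') j j<i)
          (proj₁ (firstDiff-just (X n) (X (suc n)) (proj₁ (φ₁-pair (step n n<k')))) j j<i)

  -- Block i alternates between a and b, so it returns after an even number
  -- of steps.
  walk-even : a ≢ b → ∀ h → h * 2 ≤ k' → lookup (X (h * 2)) i ≡ lookup (X 0) i
  walk-even a≢b zero _ = refl
  walk-even a≢b (suc h) 2+2h≤k' =
    trans (samePair-return a≢b (proj₂ (φ₁-pair (step (h * 2) 2h<k')))
                               (proj₂ (φ₁-pair (step (suc (h * 2)) 2+2h≤k'))))
          (walk-even a≢b h (≤-trans (m≤n+m (h * 2) 2) 2+2h≤k'))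
    where
      2h<k' : h * 2 < k'
      2h<k' = ≤-trans (m≤n+m (suc (h * 2)) 1) 2+2h≤k'

-- A closed walk X 0, …, X k' with proper steps of colour C, closed by the
-- proper step X k' X 0 of colour C': an edge C → C' of D, indexed by ℕ.
record ClosedWalk {ℓ} (C C' : Color ℓ) (k' : ℕ) : Set where
  field
    X : ℕ → V ℓ
    nonempty : 0 < k'
    step : ∀ n → n < k' → φ₁ (X n) (X (suc n)) ≈ᶜ C
    closing : φ₁ (X k') (X 0) ≈ᶜ C'
    first-step-proper : X 0 ≢ X 1
    closing-step-proper : X k' ≢ X 0

closedWalk-level : ∀ {ℓ} {C C' : Color ℓ} {k'} → ClosedWalk C C' k' →
  level C ≤ level C' × (∀ h → k' ≡ h * 2 → level C < level C')
closedWalk-level {C = nothing , _} W =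
  ⊥-elim (φ₁-defined first-step-proper (step 0 nonempty))
  where open ClosedWalk W
closedWalk-level {C = just (i , a , b) , is} {C'} {k'} W = weak , strict
  where
    open ClosedWalk W
    open MonochromaticWalk X k' i a b is step

    closing-block = firstDiff-≢ (X k') (X 0) closing-step-proper

    level-C' : level C' ≡ toℕ (proj₁ closing-block)
    level-C' = φ₁-level C' closing (proj₂ closing-block)

    agree : AgreeBelow (toℕ i) (X k') (X 0)
    agree = agreeBelow-sym {x = X 0} {y = X k'} (walk-agreeBelow k' ≤-refl)

    weak : toℕ i ≤ level C'
    weak = subst (toℕ i ≤_) (sym level-C') (firstDiff-beyond (X k') (X 0) agree (proj₂ closing-block))

    -- The pair recorded in C is proper, since the first step is.
    a≢b : a ≢ b
    a≢b = samePair-distinct (proj₂ first-pair)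
            (proj₂ (firstDiff-just (X 0) (X 1) (proj₁ first-pair)))
      where first-pair = φ₁-pair (step 0 nonempty)

    strict : ∀ h → k' ≡ h * 2 → toℕ i < level C'
    strict h k'≡2h = subst (toℕ i <_) (sym level-C')
      (firstDiff-beyond (X k') (X 0) (agreeBelow-extend {x = X k'} {y = X 0} i agree block-i) (proj₂ closing-block))
      where
        block-i : lookup (X k') i ≡ lookup (X 0) i
        block-i = subst (λ n → lookup (X n) i ≡ lookup (X 0) i) (sym k'≡2h)
                    (walk-even a≢b h (subst (h * 2 ≤_) (sym k'≡2h) ≤-refl))

toℕ-mod : ∀ k n → toℕ (n mod suc k) ≡ n % suc k
toℕ-mod k n = toℕ-fromℕ< _

toℕ-mod-small : ∀ {k n} → n < suc k → toℕ (n mod suc k) ≡ n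
toℕ-mod-small {k} {n} n<k = trans (toℕ-mod k n) (m<n⇒m%n≡m n<k)

mod-toℕ : ∀ {k n} (t : Fin (suc k)) → toℕ t ≡ n → n mod suc k ≡ t
mod-toℕ t refl = toℕ-injective (toℕ-mod-small (toℕ<n t))

dEdge⇒closedWalk : ∀ {ℓ p} {w : Fin p → V ℓ} {C C' : Color ℓ} {k'} →
  Injective _≡_ _≡_ w → DEdgeWith w C C' k' → ClosedWalk C C' k'
dEdge⇒closedWalk {ℓ} {w = w} {C} {C'} {k'} w-inj (2≤k' , v , v-inj , path , close) = record
  { X = X
  ; nonempty = 0<k'
  ; step = step
  ; closing = subst₂ (λ x y → φ₁ x y ≈ᶜ C') (sym (X-at (fromℕ k') (toℕ-fromℕ k'))) (sym (X-at zero refl)) close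
  ; first-step-proper = λ same → 0≢1+n (X-injective z≤n 0<k' same)
  ; closing-step-proper = λ same → <⇒≢ 0<k' (sym (X-injective ≤-refl z≤n same))
  }
  where
    0<k' : 0 < k'
    0<k' = ≤-trans (s≤s z≤n) 2≤k'

    X : ℕ → V ℓ
    X n = w (v (n mod suc k'))

    X-at : ∀ {n} (t : Fin (suc k')) → toℕ t ≡ n → X n ≡ w (v t)
    X-at t t≡n = cong (λ s → w (v s)) (mod-toℕ t t≡n)

    X-injective : ∀ {n m} → n ≤ k' → m ≤ k' → X n ≡ X m → n ≡ m
    X-injective {n} {m} n≤k' m≤k' same = begin
      n                      ≡⟨ sym (toℕ-mod-small (s≤s n≤k')) ⟩
      toℕ (n mod suc k')     ≡⟨ cong toℕ (v-inj (w-inj same)) ⟩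
      toℕ (m mod suc k')     ≡⟨ toℕ-mod-small (s≤s m≤k') ⟩
      m                      ∎
      where open ≡-Reasoning

    step : ∀ n → n < k' → φ₁ (X n) (X (suc n)) ≈ᶜ C
    step n n<k' = subst₂ (λ x y → φ₁ x y ≈ᶜ C)
      (sym (X-at (inject₁ t) (trans (toℕ-inject₁ t) (toℕ-fromℕ< n<k'))))
      (sym (X-at (suc t) (cong suc (toℕ-fromℕ< n<k'))))
      (path t)
      where t = fromℕ< n<k'

odd⇒pred-even : ∀ k' → suc k' % 2 ≡ 1 → k' ≡ (suc k' / 2) * 2
odd⇒pred-even k' odd =
  suc-injective (trans (m≡m%n+[m/n]*n (suc k') 2) (cong (_+ (suc k' / 2) * 2) odd))

edge-level : ∀ {ℓ p} {w : Fin p → V ℓ} {C C' : Color ℓ} →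
  Injective _≡_ _≡_ w → DEdge w C C' → level C ≤ level C'
edge-level w-inj (_ , edge) = proj₁ (closedWalk-level (dEdge⇒closedWalk w-inj edge))

oddEdge-level : ∀ {ℓ p} {w : Fin p → V ℓ} {C C' : Color ℓ} →
  Injective _≡_ _≡_ w → OddDEdge w C C' → level C < level C'
oddEdge-level w-inj (k' , edge , odd) =
  proj₂ (closedWalk-level (dEdge⇒closedWalk w-inj edge)) (suc k' / 2) (odd⇒pred-even k' odd)

module _ {m' : ℕ} where

  csucⁿ : ℕ → Fin (suc m') → Fin (suc m')
  csucⁿ zero t = t
  csucⁿ (suc n) t = csucⁿ n (csuc t)

  [m%d+n]%d≡[m+n]%d : ∀ m n → (m % suc m' + n) % suc m' ≡ (m + n) % suc m'
  [m%d+n]%d≡[m+n]%d m n = begin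
    (m % d + n) % d            ≡⟨ %-distribˡ-+ (m % d) n d ⟩
    (m % d % d + n % d) % d    ≡⟨ cong (λ r → (r + n % d) % d) (m%n%n≡m%n m d) ⟩
    (m % d + n % d) % d        ≡⟨ sym (%-distribˡ-+ m n d) ⟩
    (m + n) % d                ∎
    where
      open ≡-Reasoning
      d = suc m'

  toℕ-csucⁿ : ∀ n t → toℕ (csucⁿ n t) ≡ (toℕ t + n) % suc m'
  toℕ-csucⁿ zero t = sym (trans (cong (_% suc m') (+-identityʳ (toℕ t))) (m<n⇒m%n≡m (toℕ<n t)))
  toℕ-csucⁿ (suc n) t = begin
    toℕ (csucⁿ n (csuc t))                ≡⟨ toℕ-csucⁿ n (csuc t) ⟩
    (toℕ (csuc t) + n) % suc m'           ≡⟨ cong (λ r → (r + n) % suc m') (toℕ-mod m' (suc (toℕ t))) ⟩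
    (suc (toℕ t) % suc m' + n) % suc m'   ≡⟨ [m%d+n]%d≡[m+n]%d (suc (toℕ t)) n ⟩
    (suc (toℕ t) + n) % suc m'            ≡⟨ cong (_% suc m') (sym (+-suc (toℕ t) n)) ⟩
    (toℕ t + suc n) % suc m'              ∎
    where open ≡-Reasoning

  csucⁿ-period : ∀ t → csucⁿ (suc m') t ≡ t
  csucⁿ-period t = toℕ-injective (begin
    toℕ (csucⁿ (suc m') t)    ≡⟨ toℕ-csucⁿ (suc m') t ⟩
    (toℕ t + suc m') % suc m' ≡⟨ [m+n]%n≡m%n (toℕ t) (suc m') ⟩
    toℕ t % suc m'            ≡⟨ m<n⇒m%n≡m (toℕ<n t) ⟩
    toℕ t                     ∎)
    where open ≡-Reasoning

  -- A function nondecreasing along the cyclic successor never increases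
  -- strictly: going once around the cycle comes back to the same value.
  cyclic-no-increase : (f : Fin (suc m') → ℕ) → (∀ t → f t ≤ f (csuc t)) →
    ∀ t → ¬ f t < f (csuc t)
  cyclic-no-increase f mono t increase =
    <-irrefl refl (<-≤-trans increase (subst (λ s → f (csuc t) ≤ f s) (csucⁿ-period t)
                                             (monotone m' (csuc t))))
    where
      monotone : ∀ n s → f s ≤ f (csucⁿ n s)
      monotone zero s = ≤-refl
      monotone (suc n) s = ≤-trans (mono s) (monotone n (csuc s))

lemma3 : (ℓ : ℕ) → 1 ≤ ℓ → (p : ℕ) → 3 ≤ p →
    (w : Fin p → V ℓ) → Injective _≡_ _≡_ w → ¬ OddCycle w
lemma3 ℓ _ p _ w w-inj (m' , C , _ , edges , (t , oddEdge)) =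
  cyclic-no-increase (λ s → level (C s)) (λ s → edge-level w-inj (edges s)) t
    (oddEdge-level w-inj oddEdge)
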